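{- For any two positive integers $n$ and $k$ with $10\leq k\leq \frac{4n}{5}$, there exists a graph $G$ of order $n$ with $\gamma_{t[1,2]}(G)=k$.
   Context: All graphs are finite, simple and undirected; $N(v)$ denotes the neighborhood of $v$. A set $S\subseteq V(G)$ is a total $[1,2]$-set of $G$ if $1\leq |N(v)\cap S|\leq 2$ for every vertex $v\in V(G)$. $\gamma_{t[1,2]}(G)$ is the minimum cardinality of a total $[1,2]$-set of $G$, with $\gamma_{t[1,2]}(G)=+\infty$ if no such set exists. -}

module Defs where

open import Data.Nat using (ℕ; _≤_)
open import Data.Bool using (Bool; true; false)
open import Data.Fin using (Fin)
open import Data.Fin.Subset using (Subset; _∩_; ∣_∣)
open import Data.Vec using (tabulate)
open import Data.Product using (_×_; Σ; ∃)
open import Relation.Binary.PropositionalEquality using (_≡_)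

record Graph (n : ℕ) : Set where
  field
    adj   : Fin n → Fin n → Bool
    sym   : ∀ u v → adj u v ≡ adj v u
    irrefl : ∀ v → adj v v ≡ false

open Graph public

N : ∀ {n} → Graph n → Fin n → Subset n
N G v = tabulate (adj G v)

IsTotal12Set : ∀ {n} → Graph n → Subset n → Set
IsTotal12Set G S = ∀ v → 1 ≤ ∣ N G v ∩ S ∣ × ∣ N G v ∩ S ∣ ≤ 2

Gammat12≡ : ∀ {n} → Graph n → ℕ → Set
Gammat12≡ G k =
  (Σ (Subset _) λ S → IsTotal12Set G S × ∣ S ∣ ≡ k)
  × (∀ S → IsTotal12Set G S → k ≤ ∣ S ∣)

-- If every member v of a total [1,2]-set S of size k is adjacent to a leaf w, then any
-- total [1,2]-set dominates w and so contains v; hence γ_{t[1,2]}(G) = k. Such graphs are P₄ (k = 2) and a spider on six vertices (k = 3); adding a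
-- K₂ component raises n and k by 2, and leaves hung on a support vertex that is not
-- itself a leaf raise n alone. Since 5k ≤ 4n and k ≥ 10 give n ≥ k + 3, every pair is reached.
module Submission where

open import Defs
open import Data.Bool.Properties using (∧-zeroʳ) renaming (_≟_ to _≟ᵇ_)
open import Data.Fin using (Fin; zero; suc; _≟_)
open import Data.Fin.Patterns using (0F; 1F; 2F; 3F)
open import Data.Fin.Properties using (all?; any?; suc-injective)
open import Data.Fin.Subset using (Subset; inside; outside; _∈_; _∩_; ∣_∣; ⁅_⁆; ⊥; Nonempty)
open import Data.Fin.Subset.Properties
  using (_∈?_; nonempty?; Empty-unique; ∣⊥∣≡0; ∩-zeroˡ; x∈p∩q⁻; x∈⁅y⁆⇒x≡y; x≢y⇒x∉⁅y⁆; p⊆q⇒∣p∣≤∣q∣)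
open import Data.Nat using (ℕ; zero; suc; _+_; _*_; _≤_; _≤′_; ≤′-refl; ≤′-step; z≤n; s≤s; _≤?_)
open import Data.Nat.Properties
  using (≤-trans; n≤1+n; ≤⇒≤′; *-cancelˡ-<; *-distribˡ-+; +-monoˡ-<; +-monoˡ-≤; module ≤-Reasoning)
open import Data.Product using (Σ; ∃; _×_; _,_; proj₁)
open import Data.Vec using ([]; _∷_; lookup; here; there)
open import Data.Vec.Properties using (tabulate∘lookup; lookup⇒[]=; lookup-replicate)
  renaming (≡-dec to ≡-decVec)
open import Relation.Nullary using (yes; no; contradiction)
open import Relation.Nullary.Decidable using (True; toWitness; ¬?; _×-dec_; _→-dec_)
open import Relation.Binary.PropositionalEquality using (_≡_; _≢_; refl; cong; cong₂; subst; trans)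

private variable
  n k : ℕ

1≤∣p∣⇒Nonempty : (p : Subset n) → 1 ≤ ∣ p ∣ → Nonempty p
1≤∣p∣⇒Nonempty {n} p 1≤∣p∣ with nonempty? p
... | yes ne = ne
... | no ¬ne with () ← subst (1 ≤_) (trans (cong ∣_∣ (Empty-unique ¬ne)) (∣⊥∣≡0 n)) 1≤∣p∣

1≤∣⁅x⁆∩p∣⇒x∈p : ∀ {x : Fin n} p → 1 ≤ ∣ ⁅ x ⁆ ∩ p ∣ → x ∈ p
1≤∣⁅x⁆∩p∣⇒x∈p {x = x} p 1≤ with y , y∈ ← 1≤∣p∣⇒Nonempty (⁅ x ⁆ ∩ p) 1≤
  with y∈⁅x⁆ , y∈p ← x∈p∩q⁻ ⁅ x ⁆ p y∈ = subst (_∈ p) (x∈⁅y⁆⇒x≡y x y∈⁅x⁆) y∈p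

x∈p⇒∣⁅x⁆∩p∣≡1 : ∀ {x : Fin n} {p} → x ∈ p → ∣ ⁅ x ⁆ ∩ p ∣ ≡ 1
x∈p⇒∣⁅x⁆∩p∣≡1 {suc n} {x = zero} {inside ∷ p} here =
  cong suc (trans (cong ∣_∣ (∩-zeroˡ p)) (∣⊥∣≡0 n))
x∈p⇒∣⁅x⁆∩p∣≡1 {x = suc x} {_ ∷ p} (there x∈p) = x∈p⇒∣⁅x⁆∩p∣≡1 x∈p

lookup-⁅y⁆-≢ : ∀ {x y : Fin n} → x ≢ y → lookup ⁅ y ⁆ x ≡ outside
lookup-⁅y⁆-≢ {x = x} {y} x≢y with lookup ⁅ y ⁆ x in eq
... | outside = refl
... | inside = contradiction (lookup⇒[]= x ⁅ y ⁆ eq) (x≢y⇒x∉⁅y⁆ x≢y)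

addVertex : Graph n → Subset n → Graph (suc n)
addVertex {n} G A = record { adj = adj′ ; sym = sym′ ; irrefl = irrefl′ }
  where
  adj′ : Fin (suc n) → Fin (suc n) → _
  adj′ zero    zero    = outside
  adj′ zero    (suc v) = lookup A v
  adj′ (suc u) zero    = lookup A u
  adj′ (suc u) (suc v) = adj G u v

  sym′ : ∀ u v → adj′ u v ≡ adj′ v u
  sym′ zero    zero    = refl
  sym′ zero    (suc v) = refl
  sym′ (suc u) zero    = refl
  sym′ (suc u) (suc v) = sym G u v

  irrefl′ : ∀ v → adj′ v v ≡ outside
  irrefl′ zero    = refl
  irrefl′ (suc v) = irrefl G v

N-addVertex-new : (G : Graph n) (A : Subset n) → N (addVertex G A) zero ≡ outside ∷ A
N-addVertex-new G A = cong (outside ∷_) (tabulate∘lookup A)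

attachLeaf : Graph n → Fin n → Graph (suc n)
attachLeaf G v = addVertex G ⁅ v ⁆

K₂⊕_ : Graph n → Graph (2 + n)
K₂⊕ G = addVertex (addVertex G ⊥) ⁅ zero ⁆

empty : Graph 0
empty = record { adj = λ () ; sym = λ () ; irrefl = λ () }

-- vertex i is adjacent to i + 1
path : ∀ n → Graph (suc n)
path zero    = addVertex empty []
path (suc n) = addVertex (path n) ⁅ zero ⁆

-- the path 1 – 2 – 3 – 4 – 5 with an extra leaf 0 at the vertex 3
spider : Graph 6
spider = addVertex (path 4) ⁅ 2F ⁆

record Certificate (G : Graph n) (k : ℕ) : Set where
  field
    set     : Subset n
    total   : IsTotal12Set G set
    size    : ∣ set ∣ ≡ k
    hub     : Fin n
    hub∈set : hub ∈ set
    leaf    : ∀ v → v ∈ set → ∃ λ w → w ≢ hub × N G w ≡ ⁅ v ⁆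

certificate⇒γ≡ : {G : Graph n} → Certificate G k → Gammat12≡ G k
certificate⇒γ≡ {k = k} {G = G} C = (set , total , size) , minimal
  where
  open Certificate C
  minimal : ∀ S → IsTotal12Set G S → k ≤ ∣ S ∣
  minimal S S-total = subst (_≤ ∣ S ∣) size (p⊆q⇒∣p∣≤∣q∣ set⊆S)
    where
    set⊆S : ∀ {v} → v ∈ set → v ∈ S
    set⊆S {v} v∈set with w , _ , Nw≡⁅v⁆ ← leaf v v∈set =
      1≤∣⁅x⁆∩p∣⇒x∈p S (subst (λ p → 1 ≤ ∣ p ∩ S ∣) Nw≡⁅v⁆ (proj₁ (S-total w)))

leaf-total : ∀ {p : Subset n} S {v} → p ≡ ⁅ v ⁆ → v ∈ S → 1 ≤ ∣ p ∩ S ∣ × ∣ p ∩ S ∣ ≤ 2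
leaf-total S refl v∈S rewrite x∈p⇒∣⁅x⁆∩p∣≡1 {p = S} v∈S = s≤s z≤n , s≤s z≤n

attachLeaf-certificate : {G : Graph n} (C : Certificate G k) →
                         Certificate (attachLeaf G (Certificate.hub C)) k
attachLeaf-certificate {G = G} C = record
  { set = outside ∷ set ; total = total′ ; size = size
  ; hub = suc hub ; hub∈set = there hub∈set ; leaf = leaf′ }
  where
  open Certificate C
  total′ : IsTotal12Set (attachLeaf G hub) (outside ∷ set)
  total′ zero    = leaf-total (outside ∷ set) (N-addVertex-new G ⁅ hub ⁆) (there hub∈set)
  total′ (suc u) rewrite ∧-zeroʳ (lookup ⁅ hub ⁆ u) = total u
  leaf′ : ∀ v → v ∈ outside ∷ set → ∃ λ w → w ≢ suc hub × N (attachLeaf G hub) w ≡ ⁅ v ⁆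
  leaf′ (suc v) (there v∈set) with w , w≢hub , Nw≡⁅v⁆ ← leaf v v∈set =
    suc w , (λ eq → w≢hub (suc-injective eq)) ,
    trans (cong (_∷ N G w) (lookup-⁅y⁆-≢ w≢hub)) (cong (outside ∷_) Nw≡⁅v⁆)

K₂⊕-certificate : {G : Graph n} → Certificate G k → Certificate (K₂⊕ G) (2 + k)
K₂⊕-certificate {G = G} C = record
  { set = inside ∷ inside ∷ set ; total = total′ ; size = cong (2 +_) size
  ; hub = suc (suc hub) ; hub∈set = there (there hub∈set) ; leaf = leaf′ }
  where
  open Certificate C
  N0≡⁅1⁆ : N (K₂⊕ G) 0F ≡ ⁅ 1F ⁆
  N0≡⁅1⁆ = N-addVertex-new (addVertex G ⊥) ⁅ zero ⁆
  N1≡⁅0⁆ : N (K₂⊕ G) 1F ≡ ⁅ 0F ⁆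
  N1≡⁅0⁆ = cong (inside ∷_) (N-addVertex-new G ⊥)
  total′ : IsTotal12Set (K₂⊕ G) (inside ∷ inside ∷ set)
  total′ 0F = leaf-total (inside ∷ inside ∷ set) N0≡⁅1⁆ (there here)
  total′ 1F = leaf-total (inside ∷ inside ∷ set) N1≡⁅0⁆ here
  total′ (suc (suc u)) rewrite lookup-replicate u outside = total u
  leaf′ : ∀ v → v ∈ inside ∷ inside ∷ set →
          ∃ λ w → w ≢ suc (suc hub) × N (K₂⊕ G) w ≡ ⁅ v ⁆
  leaf′ 0F here = 1F , (λ ()) , N1≡⁅0⁆
  leaf′ 1F (there here) = 0F , (λ ()) , N0≡⁅1⁆
  leaf′ (suc (suc v)) (there (there v∈set)) with w , w≢hub , Nw≡⁅v⁆ ← leaf v v∈set =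
    suc (suc w) , (λ eq → w≢hub (suc-injective (suc-injective eq))) ,
    cong₂ (λ b p → b ∷ b ∷ p) (lookup-replicate w outside) Nw≡⁅v⁆

decideCertificate : (G : Graph n) (S : Subset n) (h : Fin n) →
  {True (all? λ v → 1 ≤? ∣ N G v ∩ S ∣ ×-dec ∣ N G v ∩ S ∣ ≤? 2)} → {True (h ∈? S)} →
  {True (all? λ v → v ∈? S →-dec any? λ w → ¬? (w ≟ h) ×-dec ≡-decVec _≟ᵇ_ (N G w) ⁅ v ⁆)} →
  Certificate G ∣ S ∣
decideCertificate G S h {total} {h∈S} {leaf} = record
  { set = S ; total = toWitness total ; size = refl
  ; hub = h ; hub∈set = toWitness h∈S ; leaf = toWitness leaf }

P₄-certificate : Certificate (path 3) 2
P₄-certificate = decideCertificate (path 3) (outside ∷ inside ∷ inside ∷ outside ∷ []) 1F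

spider-certificate : Certificate spider 3
spider-certificate =
  decideCertificate spider (outside ∷ outside ∷ inside ∷ inside ∷ inside ∷ outside ∷ []) 3F

Realisable : ℕ → ℕ → Set
Realisable n k = Σ (Graph n) λ G → Certificate G k

attachLeaves : ∀ {m} → n ≤′ m → Realisable n k → Realisable m k
attachLeaves ≤′-refl        R       = R
attachLeaves (≤′-step n≤′m) R with G , C ← attachLeaves n≤′m R =
  attachLeaf G (Certificate.hub C) , attachLeaf-certificate C

realisable : 2 ≤ k → 3 + k ≤ n → Realisable n k
realisable {k = 1} (s≤s ())
realisable {k = 2} _ 5≤n = attachLeaves (≤⇒≤′ (≤-trans (n≤1+n 4) 5≤n)) (path 3 , P₄-certificate)
realisable {k = 3} _ 6≤n = attachLeaves (≤⇒≤′ 6≤n) (spider , spider-certificate)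
realisable {k = suc (suc k@(suc (suc _)))} _ (s≤s (s≤s 3+k≤n))
  with G , C ← realisable {k = k} (s≤s (s≤s z≤n)) 3+k≤n = K₂⊕ G , K₂⊕-certificate C

3+k≤n : ∀ {n k} → 10 ≤ k → 5 * k ≤ 4 * n → 3 + k ≤ n
3+k≤n {n} {k} 10≤k 5k≤4n = *-cancelˡ-< 4 (2 + k) n (begin-strict
  4 * (2 + k) ≡⟨ *-distribˡ-+ 4 2 k ⟩
  8 + 4 * k   <⟨ +-monoˡ-< (4 * k) (n≤1+n 9) ⟩
  10 + 4 * k  ≤⟨ +-monoˡ-≤ (4 * k) 10≤k ⟩
  k + 4 * k   ≤⟨ 5k≤4n ⟩
  4 * n       ∎)
  where open ≤-Reasoning

proposition2p4 : (n k : ℕ) → 10 ≤ k → 5 * k ≤ 4 * n →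
    Σ (Graph n) λ G → Gammat12≡ G k
proposition2p4 n k 10≤k 5k≤4n
  with G , C ← realisable (≤-trans (s≤s (s≤s z≤n)) 10≤k) (3+k≤n 10≤k 5k≤4n) =
  G , certificate⇒γ≡ C
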